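{- Let $k \geq 2$ and $n \ge 2$. For every deterministic adaptive $\ell_k$-local strategy for permutation Mastermind played against a generous codemaker, there is a secret $\sigma^\star \in S_n$ for which the strategy makes at least $\frac{n^2-3n}{2k}$ guesses before winning.
   Context: Permutation Mastermind: a secret $\sigma^\star \in S_n$ is chosen; the codebreaker makes guesses $\pi_1,\pi_2,\ldots\in S_n$ and wins when a guess equals $\sigma^\star$. A deterministic adaptive strategy chooses each guess as a function of all feedback received so far. It is $\ell_k$-local if any two consecutive guesses differ in at most $k$ positions, i.e. $|\{i : \pi_t(i)\neq\pi_{t+1}(i)\}| \le k$. A generous codemaker gives the following feedback: after the first guess $\pi_1$ it reveals, for every position $i\in[n]$, whether $\pi_1(i) = \sigma^\star(i)$; after each later guess $\pi_t$ it reveals, for every position $i$ with $\pi_t(i)\neq\pi_{t-1}(i)$, whether $\pi_t(i) = \sigma^\star(i)$. -}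

module Defs where

open import Data.Nat using (ℕ; zero; suc; _≤_)
open import Data.Bool using (Bool)
open import Data.Maybe using (Maybe; just; nothing)
open import Data.List using (List; []; _∷_; length; filter)
open import Data.Fin using (Fin; _≟_)
open import Data.Fin.Permutation using (Permutation′; _⟨$⟩ʳ_; _≈_)
open import Data.Vec using (Vec; tabulate)
open import Data.List using (allFin) renaming (_∷_ to _∷ₗ_)
open import Relation.Nullary using (¬_; does; ¬?)

-- Feedback after one guess: for every position i, either `nothing`
-- (position not revealed) or `just b` with b = (guess(i) == secret(i)).
Feedback : ℕ → Set
Feedback n = Vec (Maybe Bool) n

-- Deterministic adaptive strategy: next guess as a function of all feedback
-- received so far (most recent feedback first).
Strategy : ℕ → Set
Strategy n = List (Feedback n) → Permutation′ n

firstFeedback : ∀ {n} → Permutation′ n → Permutation′ n → Feedback n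
firstFeedback π σ = tabulate λ i → just (does ((π ⟨$⟩ʳ i) ≟ (σ ⟨$⟩ʳ i)))

laterFeedback : ∀ {n} → Permutation′ n → Permutation′ n → Permutation′ n → Feedback n
laterFeedback π π₀ σ = tabulate λ i →
  Data.Bool.if does ((π ⟨$⟩ʳ i) ≟ (π₀ ⟨$⟩ʳ i))
  then nothing
  else just (does ((π ⟨$⟩ʳ i) ≟ (σ ⟨$⟩ʳ i)))

-- history S σ t = feedback list after the first t guesses (guesses 0..t-1).
history : ∀ {n} → Strategy n → Permutation′ n → ℕ → List (Feedback n)
history S σ zero = []
history S σ (suc zero) = firstFeedback (S []) σ ∷ []
history S σ (suc (suc t)) =
  laterFeedback (S (history S σ (suc t))) (S (history S σ t)) σ ∷ history S σ (suc t)

-- guess S σ t = the (t+1)-th guess (0-indexed t) when the secret is σ.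
guess : ∀ {n} → Strategy n → Permutation′ n → ℕ → Permutation′ n
guess S σ t = S (history S σ t)

diffCount : ∀ {n} → Permutation′ n → Permutation′ n → ℕ
diffCount {n} π ρ = length (filter (λ i → ¬? ((π ⟨$⟩ʳ i) ≟ (ρ ⟨$⟩ʳ i))) (allFin n))

Local : ∀ {n} → ℕ → Strategy n → Set
Local k S = ∀ σ t → (∀ s → s ≤ t → ¬ (guess S σ s ≈ σ)) →
  diffCount (guess S σ t) (guess S σ (suc t)) ≤ k

{-# OPTIONS --safe #-}
-- The codemaker answers adversarially. A cell (a , w) is queried once some guess
-- has put value w at position a, and a position is confirmed once its secret
-- value has been queried there. The potential counts the queried cells in the row
-- of a confirmed position or in the column of a confirmed value, and the
-- invariant is n² ≤ 2·potential + u², u being the number of unconfirmed positions.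
--
-- After each guess the adversary keeps swapping its secret values at two
-- positions that were unconfirmed, one of them confirmed by the new guess, as long
-- as no queried cell rules the swap out. A swap changes no earlier answer, so the
-- play so far is unchanged, and it lowers the number of newly confirmed positions,
-- so the swapping stops. Then each pair of formerly unconfirmed positions one of
-- which is now confirmed is blocked by a queried cell in the row of one of them
-- and the column of the other's value; these cells are new to the potential and
-- there are at least half as many of them as such pairs, which preserves the
-- invariant. When the secret is guessed u = 0, so 2·potential ≥ n², while the
-- first guess queries n cells and every later one at most k new ones.
module Submission where

open import Defs
open import Data.Nat using (ℕ; suc; _+_; _*_; _≤_)
open import Data.Product using (∃; _,_)
open import Data.Fin.Permutation using (Permutation′; _≈_)

open import Data.Bool using (Bool; true; false; not; _∧_; _∨_; T; if_then_else_)
open import Data.Bool.Properties using (T-∨; ∨-comm)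
import Data.Bool.Properties as Bool
open import Data.Empty using (⊥-elim)
open import Data.Fin using (Fin; zero; suc; _≟_)
open import Data.Fin.Permutation using (_⟨$⟩ʳ_; _⟨$⟩ˡ_; inverseˡ; inverseʳ; transpose; _∘ₚ_; id)
import Data.Fin.Permutation.Components as PC
open import Data.Fin.Properties using (any?; all?)
open import Data.List using ([]; _∷_; length; filter; tabulate)
open import Data.Maybe using (just; nothing)
open import Data.Nat using (zero; _∸_; _<_; z≤n; s≤s; _<?_)
open import Data.Nat.Induction using (<-rec)
open import Data.Nat.Properties hiding (_≟_)
open import Data.Nat.Tactic.RingSolver using (solve-∀)
open import Data.Product using (_×_; proj₁; proj₂)
open import Data.Sum using (_⊎_; inj₁; inj₂)
import Data.Sum as Sum
open import Data.Vec.Properties using (tabulate-cong)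
open import Function using (_∘_; _⇔_; mk⇔; Equivalence)
import Function.Properties.Equivalence as ⇔
open import Relation.Binary.PropositionalEquality
open import Relation.Nullary using (¬_; Dec; yes; no; does; _×-dec_; ¬?)
open import Relation.Nullary.Decidable using (does-⇔; T?; map′; dec-true)
open import Relation.Unary using (Decidable)
open import Algebra.Properties.Semiring.Sum +-*-semiring
  using (sum; sum-syntax; sum-cong-≗; ∑-distrib-+; ∑-comm; sum-permute;
         *-distribˡ-sum; *-distribʳ-sum; sum-replicate-zero)

private variable
  n : ℕ
  σ σ′ σ″ : Permutation′ n

-- Indicator sums

𝟙 : Bool → ℕ
𝟙 false = 0
𝟙 true = 1

𝟙≤1 : ∀ b → 𝟙 b ≤ 1
𝟙≤1 false = z≤n
𝟙≤1 true = ≤-refl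

𝟙-∧-false : ∀ {x y} → ¬ T y → 𝟙 (x ∧ y) ≡ 0
𝟙-∧-false {false} _ = refl
𝟙-∧-false {true} {false} _ = refl
𝟙-∧-false {true} {true} ¬y = ⊥-elim (¬y _)

𝟙-∧-≤ʳ : ∀ x y → 𝟙 (x ∧ y) ≤ 𝟙 y
𝟙-∧-≤ʳ false y = z≤n
𝟙-∧-≤ʳ true y = ≤-refl

𝟙-not-true : ∀ {x} → T x → 𝟙 (not x) ≡ 0
𝟙-not-true {true} _ = refl

0<𝟙-not∧ : ∀ {x y} → ¬ T x → T y → 0 < 𝟙 (not x ∧ y)
0<𝟙-not∧ {false} {true} _ _ = ≤-refl
0<𝟙-not∧ {true} ¬x _ = ⊥-elim (¬x _)

T-injective : ∀ {x y} → (T x → T y) → (T y → T x) → x ≡ y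
T-injective {false} {false} _ _ = refl
T-injective {false} {true} _ y⇒x = ⊥-elim (y⇒x _)
T-injective {true} {false} x⇒y _ = ⊥-elim (x⇒y _)
T-injective {true} {true} _ _ = refl

∨-mono-T : ∀ {x x′ y y′} → (T x → T x′) → (T y → T y′) → T (x ∨ y) → T (x′ ∨ y′)
∨-mono-T f g = Equivalence.from T-∨ ∘ Sum.map f g ∘ Equivalence.to T-∨

∑-mono-≤ : {f g : Fin n → ℕ} → (∀ i → f i ≤ g i) → sum f ≤ sum g
∑-mono-≤ {zero} _ = z≤n
∑-mono-≤ {suc n} f≤g = +-mono-≤ (f≤g zero) (∑-mono-≤ (f≤g ∘ suc))

∑-mono-< : {f g : Fin n → ℕ} → (∀ i → f i ≤ g i) → ∀ j → f j < g j → sum f < sum g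
∑-mono-< f≤g zero fj<gj = +-mono-<-≤ fj<gj (∑-mono-≤ (f≤g ∘ suc))
∑-mono-< f≤g (suc j) fj<gj = +-mono-≤-< (f≤g zero) (∑-mono-< (f≤g ∘ suc) j fj<gj)

∑∑-mono-≤ : ∀ {m n} {f g : Fin m → Fin n → ℕ} → (∀ i j → f i j ≤ g i j) →
  ∑[ i < m ] ∑[ j < n ] f i j ≤ ∑[ i < m ] ∑[ j < n ] g i j
∑∑-mono-≤ f≤g = ∑-mono-≤ λ i → ∑-mono-≤ (f≤g i)

∑∑-distrib-+ : ∀ {m n} (f g : Fin m → Fin n → ℕ) →
  ∑[ i < m ] ∑[ j < n ] (f i j + g i j) ≡ ∑[ i < m ] ∑[ j < n ] f i j + ∑[ i < m ] ∑[ j < n ] g i j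
∑∑-distrib-+ f g =
  trans (sum-cong-≗ λ i → ∑-distrib-+ (f i) (g i)) (∑-distrib-+ (λ i → sum (f i)) (λ i → sum (g i)))

∑-1 : ∑[ i < n ] 1 ≡ n
∑-1 {zero} = refl
∑-1 {suc n} = cong suc (∑-1 {n})

∑-*-∑ : ∀ {m n} (f : Fin m → ℕ) (g : Fin n → ℕ) →
  sum f * sum g ≡ ∑[ i < m ] ∑[ j < n ] (f i * g j)
∑-*-∑ f g = trans (*-distribʳ-sum (sum g) f) (sum-cong-≗ λ i → *-distribˡ-sum (f i) g)

∑-𝟙-≟ : (x : Fin n) → ∑[ w < n ] 𝟙 (does (x ≟ w)) ≡ 1
∑-𝟙-≟ {suc n} zero = cong suc (sum-replicate-zero n)
∑-𝟙-≟ {suc n} (suc x) = ∑-𝟙-≟ x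

length-filter-tabulate : ∀ {A : Set} {P : A → Set} (P? : Decidable P) (f : Fin n → A) →
  length (filter P? (tabulate f)) ≡ ∑[ i < n ] 𝟙 (does (P? (f i)))
length-filter-tabulate {zero} P? f = refl
length-filter-tabulate {suc n} P? f with does (P? (f zero))
... | true = cong suc (length-filter-tabulate P? (f ∘ suc))
... | false = length-filter-tabulate P? (f ∘ suc)

𝟙-covered : ∀ r {m m′} → (T r → T m ⊎ T m′) → 𝟙 r ≤ 𝟙 (r ∧ m) + 𝟙 (r ∧ m′)
𝟙-covered false _ = z≤n
𝟙-covered true {true} _ = s≤s z≤n
𝟙-covered true {false} {true} _ = s≤s z≤n
𝟙-covered true {false} {false} cover with cover _
... | inj₁ ()
... | inj₂ ()

orientation-bound : (R M : Fin n → Fin n → Bool) → (∀ a b → R a b ≡ R b a) →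
  (∀ a b → T (R a b) → T (M a b) ⊎ T (M b a)) →
  ∑[ a < n ] ∑[ b < n ] 𝟙 (R a b) ≤ 2 * ∑[ a < n ] ∑[ b < n ] 𝟙 (R a b ∧ M a b)
orientation-bound {n} R M R-comm cover = begin
  ∑[ a < n ] ∑[ b < n ] 𝟙 (R a b)
    ≤⟨ ∑∑-mono-≤ covered ⟩
  ∑[ a < n ] ∑[ b < n ] (𝟙 (R a b ∧ M a b) + 𝟙 (R b a ∧ M b a))
    ≡⟨ ∑∑-distrib-+ (λ a b → 𝟙 (R a b ∧ M a b)) (λ a b → 𝟙 (R b a ∧ M b a)) ⟩
  oriented + ∑[ a < n ] ∑[ b < n ] 𝟙 (R b a ∧ M b a)
    ≡⟨ cong (oriented +_) (∑-comm (λ a b → 𝟙 (R b a ∧ M b a))) ⟩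
  oriented + oriented
    ≡⟨ cong (oriented +_) (sym (+-identityʳ oriented)) ⟩
  2 * oriented ∎
  where
  open ≤-Reasoning
  oriented = ∑[ a < n ] ∑[ b < n ] 𝟙 (R a b ∧ M a b)
  covered : ∀ a b → 𝟙 (R a b) ≤ 𝟙 (R a b ∧ M a b) + 𝟙 (R b a ∧ M b a)
  covered a b rewrite R-comm b a = 𝟙-covered (R a b) (cover a b)

-- Query sets, agreement and the potential

-- q a w: value w has been tried at position a.
Queries : ℕ → Set
Queries n = Fin n → Fin n → Bool

_⊆_ : Queries n → Queries n → Set
q ⊆ q′ = ∀ {a w} → T (q a w) → T (q′ a w)

record Agree (q : Queries n) (σ σ′ : Permutation′ n) : Set where
  constructor agreeing
  field
    answer : ∀ {a w} → T (q a w) → (w ≡ σ ⟨$⟩ʳ a) ⇔ (w ≡ σ′ ⟨$⟩ʳ a)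

open Agree

private variable
  q q′ : Queries n

Agree-refl : Agree q σ σ
Agree-refl = agreeing λ _ → ⇔.refl

Agree-sym : Agree q σ σ′ → Agree q σ′ σ
Agree-sym agree = agreeing (⇔.sym ∘ answer agree)

Agree-trans : Agree q σ σ′ → Agree q σ′ σ″ → Agree q σ σ″
Agree-trans agree agree′ = agreeing λ qaw → ⇔.trans (answer agree qaw) (answer agree′ qaw)

Agree-mono : q ⊆ q′ → Agree q′ σ σ′ → Agree q σ σ′
Agree-mono q⊆q′ agree = agreeing (answer agree ∘ q⊆q′)

confirmed : Queries n → Permutation′ n → Fin n → Bool
confirmed q σ a = q a (σ ⟨$⟩ʳ a)

unconfirmed : Queries n → Permutation′ n → ℕ
unconfirmed {n} q σ = ∑[ a < n ] 𝟙 (not (confirmed q σ a))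

onConfirmedLine : Queries n → Permutation′ n → Fin n → Fin n → Bool
onConfirmedLine q σ a w = confirmed q σ a ∨ q (σ ⟨$⟩ˡ w) w

potential : Queries n → Permutation′ n → ℕ
potential {n} q σ = ∑[ a < n ] ∑[ w < n ] 𝟙 (onConfirmedLine q σ a w ∧ q a w)

-- With c = n − u confirmed positions, n² − u² = 2cn − c² counts the cells in
-- confirmed rows or columns; the invariant says that at least half of them are queried.
Invariant : Queries n → Permutation′ n → Set
Invariant {n} q σ = n * n ≤ 2 * potential q σ + unconfirmed q σ * unconfirmed q σ

confirmed-transfer : Agree q σ σ′ → ∀ a → T (confirmed q σ a) → T (confirmed q σ′ a)
confirmed-transfer {q = q} agree a qaσa =
  subst (T ∘ q a) (Equivalence.to (answer agree qaσa) refl) qaσa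

column-transfer : Agree q σ σ′ → ∀ w → T (q (σ ⟨$⟩ˡ w) w) → T (q (σ′ ⟨$⟩ˡ w) w)
column-transfer {q = q} {σ = σ} {σ′ = σ′} agree w qbw = subst (λ c → T (q c w)) b≡σ′⁻¹w qbw
  where
  b = σ ⟨$⟩ˡ w
  w≡σ′b : w ≡ σ′ ⟨$⟩ʳ b
  w≡σ′b = Equivalence.to (answer agree qbw) (sym (inverseʳ σ))
  b≡σ′⁻¹w : b ≡ σ′ ⟨$⟩ˡ w
  b≡σ′⁻¹w = sym (trans (cong (σ′ ⟨$⟩ˡ_) w≡σ′b) (inverseˡ σ′))

invariant-agree : Agree q σ σ′ → Invariant q σ → Invariant q σ′
invariant-agree {n} {q} {σ} {σ′} agree =
  subst₂ (λ p u → n * n ≤ 2 * p + u * u) potential-≡ unconfirmed-≡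
  where
  confirmed-≡ : ∀ a → confirmed q σ a ≡ confirmed q σ′ a
  confirmed-≡ a = T-injective (confirmed-transfer agree a) (confirmed-transfer (Agree-sym agree) a)
  column-≡ : ∀ w → q (σ ⟨$⟩ˡ w) w ≡ q (σ′ ⟨$⟩ˡ w) w
  column-≡ w = T-injective (column-transfer agree w) (column-transfer (Agree-sym agree) w)
  unconfirmed-≡ : unconfirmed q σ ≡ unconfirmed q σ′
  unconfirmed-≡ = sum-cong-≗ λ a → cong (𝟙 ∘ not) (confirmed-≡ a)
  potential-≡ : potential q σ ≡ potential q σ′
  potential-≡ = sum-cong-≗ λ a → sum-cong-≗ λ w →
    cong (λ c → 𝟙 (c ∧ q a w)) (cong₂ _∨_ (confirmed-≡ a) (column-≡ w))

invariant-cong : ∀ {q q′ : Queries n} → (∀ a w → q a w ≡ q′ a w) → Invariant q σ → Invariant q′ σ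
invariant-cong {n} {σ} {q} {q′} q≡q′ = subst₂ (λ p u → n * n ≤ 2 * p + u * u)
  (sum-cong-≗ λ a → sum-cong-≗ λ w →
    cong₂ (λ x y → 𝟙 (x ∧ y)) (cong₂ _∨_ (q≡q′ a _) (q≡q′ _ w)) (q≡q′ a w))
  (sum-cong-≗ λ a → cong (𝟙 ∘ not) (q≡q′ a _))

invariant-empty : ∀ (σ : Permutation′ n) → Invariant (λ _ _ → false) σ
invariant-empty {n} σ =
  subst (λ u → n * n ≤ 2 * potential (λ _ _ → false) σ + u * u) (sym (∑-1 {n})) (m≤n+m (n * n) _)

unconfirmed≡0 : (∀ a → T (confirmed q σ a)) → unconfirmed q σ ≡ 0
unconfirmed≡0 {n} all = trans (sum-cong-≗ λ a → 𝟙-not-true (all a)) (sum-replicate-zero n)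

contested : Queries n → Queries n → Permutation′ n → Fin n → Fin n → Bool
contested q q′ σ a b =
  not (confirmed q σ a ∨ confirmed q σ b) ∧ (confirmed q′ σ a ∨ confirmed q′ σ b)

-- Swapping the values of σ at a contested pair would contradict a query of q′.
Settled : Queries n → Queries n → Permutation′ n → Set
Settled q q′ σ = ∀ a b → T (contested q q′ σ a b) → T (q′ a (σ ⟨$⟩ʳ b)) ⊎ T (q′ b (σ ⟨$⟩ʳ a))

T-contested : ∀ {x y x′ y′} → T (not (x ∨ y) ∧ (x′ ∨ y′)) → ¬ T x × ¬ T y × (T x′ ⊎ T y′)
T-contested {false} {false} p = (λ ()) , (λ ()) , Equivalence.to T-∨ p

𝟙-split : ∀ {v v′ x x′} → (T v → T v′) → (T x → T x′) →
  𝟙 (v ∧ x) + 𝟙 ((not v ∧ v′) ∧ x′) ≤ 𝟙 (v′ ∧ x′)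
𝟙-split {false} _ _ = ≤-refl
𝟙-split {true} {x = false} _ _ = z≤n
𝟙-split {true} {true} {true} {true} _ _ = ≤-refl
𝟙-split {true} {false} {true} v⇒v′ _ = ⊥-elim (v⇒v′ _)
𝟙-split {true} {true} {true} {false} _ x⇒x′ = ⊥-elim (x⇒x′ _)

𝟙-contested-+-square : ∀ {x y x′ y′} → (T x → T x′) → (T y → T y′) →
  𝟙 (not (x ∨ y) ∧ (x′ ∨ y′)) + 𝟙 (not x′) * 𝟙 (not y′) ≡ 𝟙 (not x) * 𝟙 (not y)
𝟙-contested-+-square {true} {x′ = true} _ _ = refl
𝟙-contested-+-square {true} {x′ = false} x⇒x′ _ = ⊥-elim (x⇒x′ _)
𝟙-contested-+-square {false} {true} {x′} {true} _ _ = *-zeroʳ (𝟙 (not x′))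
𝟙-contested-+-square {false} {true} {y′ = false} _ y⇒y′ = ⊥-elim (y⇒y′ _)
𝟙-contested-+-square {false} {false} {true} _ _ = refl
𝟙-contested-+-square {false} {false} {false} {true} _ _ = refl
𝟙-contested-+-square {false} {false} {false} {false} _ _ = refl

freshCell : Queries n → Queries n → Permutation′ n → Fin n → Fin n → Bool
freshCell q q′ σ a w = (not (onConfirmedLine q σ a w) ∧ onConfirmedLine q′ σ a w) ∧ q′ a w

freshCells : Queries n → Queries n → Permutation′ n → ℕ
freshCells {n} q q′ σ = ∑[ a < n ] ∑[ w < n ] 𝟙 (freshCell q q′ σ a w)

contestedPairs : Queries n → Queries n → Permutation′ n → ℕ
contestedPairs {n} q q′ σ = ∑[ a < n ] ∑[ b < n ] 𝟙 (contested q q′ σ a b)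

potential-+-freshCells : q ⊆ q′ → potential q σ + freshCells q q′ σ ≤ potential q′ σ
potential-+-freshCells {n} {q} {q′} {σ} q⊆q′ = begin
  potential q σ + freshCells q q′ σ
    ≡⟨ sym (∑∑-distrib-+ (λ a w → 𝟙 (onConfirmedLine q σ a w ∧ q a w))
                          (λ a w → 𝟙 (freshCell q q′ σ a w))) ⟩
  ∑[ a < n ] ∑[ w < n ] (𝟙 (onConfirmedLine q σ a w ∧ q a w) + 𝟙 (freshCell q q′ σ a w))
    ≤⟨ ∑∑-mono-≤ (λ a w →
         𝟙-split (∨-mono-T (q⊆q′ {a}) (q⊆q′ {σ ⟨$⟩ˡ w})) (q⊆q′ {a} {w})) ⟩
  potential q′ σ ∎
  where open ≤-Reasoning

contestedPairs-≤-2*freshCells : Settled q q′ σ → contestedPairs q q′ σ ≤ 2 * freshCells q q′ σ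
contestedPairs-≤-2*freshCells {n} {q} {q′} {σ} settled =
  subst (λ y → contestedPairs q q′ σ ≤ 2 * y) (sym fresh-by-pairs)
    (orientation-bound (contested q q′ σ) (λ a b → q′ a (σ ⟨$⟩ʳ b)) contested-comm settled)
  where
  contested-comm : ∀ a b → contested q q′ σ a b ≡ contested q q′ σ b a
  contested-comm a b = cong₂ (λ x y → not x ∧ y)
    (∨-comm (confirmed q σ a) (confirmed q σ b)) (∨-comm (confirmed q′ σ a) (confirmed q′ σ b))
  fresh-by-pairs :
    freshCells q q′ σ ≡ ∑[ a < n ] ∑[ b < n ] 𝟙 (contested q q′ σ a b ∧ q′ a (σ ⟨$⟩ʳ b))
  fresh-by-pairs = sum-cong-≗ λ a → trans (sum-permute (𝟙 ∘ freshCell q q′ σ a) σ) (sum-cong-≗ λ b →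
    cong (λ c → 𝟙 ((not (confirmed q σ a ∨ q c (σ ⟨$⟩ʳ b)) ∧ (confirmed q′ σ a ∨ q′ c (σ ⟨$⟩ʳ b)))
                   ∧ q′ a (σ ⟨$⟩ʳ b)))
         (inverseˡ σ))

contestedPairs-+-unconfirmed² : q ⊆ q′ →
  contestedPairs q q′ σ + unconfirmed q′ σ * unconfirmed q′ σ ≡ unconfirmed q σ * unconfirmed q σ
contestedPairs-+-unconfirmed² {n} {q} {q′} {σ} q⊆q′ = begin
  contestedPairs q q′ σ + unconfirmed q′ σ * unconfirmed q′ σ
    ≡⟨ cong (contestedPairs q q′ σ +_) (∑-*-∑ (𝟙 ∘ not ∘ r′) (𝟙 ∘ not ∘ r′)) ⟩
  contestedPairs q q′ σ + ∑[ a < n ] ∑[ b < n ] (𝟙 (not (r′ a)) * 𝟙 (not (r′ b)))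
    ≡⟨ sym (∑∑-distrib-+ (λ a b → 𝟙 (contested q q′ σ a b))
                          (λ a b → 𝟙 (not (r′ a)) * 𝟙 (not (r′ b)))) ⟩
  ∑[ a < n ] ∑[ b < n ] (𝟙 (contested q q′ σ a b) + 𝟙 (not (r′ a)) * 𝟙 (not (r′ b)))
    ≡⟨ sum-cong-≗ (λ a → sum-cong-≗ λ b → 𝟙-contested-+-square (q⊆q′ {a}) (q⊆q′ {b})) ⟩
  ∑[ a < n ] ∑[ b < n ] (𝟙 (not (r a)) * 𝟙 (not (r b)))
    ≡⟨ sym (∑-*-∑ (𝟙 ∘ not ∘ r) (𝟙 ∘ not ∘ r)) ⟩
  unconfirmed q σ * unconfirmed q σ ∎
  where
  open ≡-Reasoning
  r r′ : Fin n → Bool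
  r = confirmed q σ
  r′ = confirmed q′ σ

invariant-extend : q ⊆ q′ → Settled q q′ σ → Invariant q σ → Invariant q′ σ
invariant-extend {n} {q} {q′} {σ} q⊆q′ settled invariant = begin
  n * n                    ≤⟨ invariant ⟩
  2 * P + u * u            ≡⟨ cong (2 * P +_) (sym C+e²≡u²) ⟩
  2 * P + (C + e * e)      ≤⟨ +-monoʳ-≤ (2 * P) (+-monoˡ-≤ (e * e) C≤2F) ⟩
  2 * P + (2 * F + e * e)  ≡⟨ sym (+-assoc (2 * P) (2 * F) (e * e)) ⟩
  2 * P + 2 * F + e * e    ≡⟨ cong (_+ e * e) (sym (*-distribˡ-+ 2 P F)) ⟩
  2 * (P + F) + e * e      ≤⟨ +-monoˡ-≤ (e * e) (*-monoʳ-≤ 2 P+F≤P′) ⟩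
  2 * potential q′ σ + e * e ∎
  where
  open ≤-Reasoning
  P = potential q σ
  F = freshCells q q′ σ
  C = contestedPairs q q′ σ
  u = unconfirmed q σ
  e = unconfirmed q′ σ
  C+e²≡u² = contestedPairs-+-unconfirmed² {q = q} {q′} {σ} q⊆q′
  C≤2F = contestedPairs-≤-2*freshCells {q = q} {q′} {σ} settled
  P+F≤P′ = potential-+-freshCells {q = q} {q′} {σ} q⊆q′

-- Settling the secret

transpose-cases : (a b x : Fin n) →
  (x ≡ a × PC.transpose a b x ≡ b) ⊎ (x ≡ b × PC.transpose a b x ≡ a) ⊎
  (x ≢ a × x ≢ b × PC.transpose a b x ≡ x)
transpose-cases a b x with x ≟ a
... | yes x≡a = inj₁ (x≡a , refl)
... | no x≢a with x ≟ b
...   | yes x≡b = inj₂ (inj₁ (x≡b , refl))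
...   | no x≢b = inj₂ (inj₂ (x≢a , x≢b , refl))

module Settle (q q′ : Queries n) (q⊆q′ : q ⊆ q′) where

  record Swappable (σ : Permutation′ n) (a b : Fin n) : Set where
    constructor swappable
    field
      contested-pair : T (contested q q′ σ a b)
      unblockedˡ : ¬ T (q′ a (σ ⟨$⟩ʳ b))
      unblockedʳ : ¬ T (q′ b (σ ⟨$⟩ʳ a))

  open Swappable

  swappable? : ∀ σ a b → Dec (Swappable σ a b)
  swappable? σ a b = map′ (λ (c , l , r) → swappable c l r)
    (λ s → contested-pair s , unblockedˡ s , unblockedʳ s) (T? _ ×-dec ¬? (T? _) ×-dec ¬? (T? _))

  contested-ends : ∀ σ a b → T (contested q q′ σ a b) →
    ¬ T (confirmed q σ a) × ¬ T (confirmed q σ b) × (T (confirmed q′ σ a) ⊎ T (confirmed q′ σ b))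
  contested-ends σ a b =
    T-contested {confirmed q σ a} {confirmed q σ b} {confirmed q′ σ a} {confirmed q′ σ b}

  swap : Permutation′ n → Fin n → Fin n → Permutation′ n
  swap σ a b = transpose a b ∘ₚ σ

  swap-cases : ∀ σ a b x → (x ≡ a ⊎ x ≡ b) ⊎ swap σ a b ⟨$⟩ʳ x ≡ σ ⟨$⟩ʳ x
  swap-cases σ a b x with transpose-cases a b x
  ... | inj₁ (x≡a , _) = inj₁ (inj₁ x≡a)
  ... | inj₂ (inj₁ (x≡b , _)) = inj₁ (inj₂ x≡b)
  ... | inj₂ (inj₂ (_ , _ , t)) = inj₂ (cong (σ ⟨$⟩ʳ_) t)

  swap-ends : ∀ {σ a b x} → Swappable σ a b → x ≡ a ⊎ x ≡ b →
    ¬ T (confirmed q σ x) × ¬ T (confirmed q′ (swap σ a b) x)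
  swap-ends {σ} {a} {b} {x} s x∈ab
    with contested-ends σ a b (contested-pair s) | transpose-cases a b x | x∈ab
  ... | ¬ra , _ | inj₁ (refl , t) | _ =
    ¬ra , subst (λ y → ¬ T (q′ a (σ ⟨$⟩ʳ y))) (sym t) (unblockedˡ s)
  ... | _ , ¬rb , _ | inj₂ (inj₁ (refl , t)) | _ =
    ¬rb , subst (λ y → ¬ T (q′ b (σ ⟨$⟩ʳ y))) (sym t) (unblockedʳ s)
  ... | _ | inj₂ (inj₂ (x≢a , _ , _)) | inj₁ x≡a = ⊥-elim (x≢a x≡a)
  ... | _ | inj₂ (inj₂ (_ , x≢b , _)) | inj₂ x≡b = ⊥-elim (x≢b x≡b)

  swap-agree : ∀ {σ a b} → Swappable σ a b → Agree q σ (swap σ a b)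
  swap-agree {σ} {a} {b} s = agreeing answer′
    where
    answer′ : ∀ {x w} → T (q x w) → (w ≡ σ ⟨$⟩ʳ x) ⇔ (w ≡ swap σ a b ⟨$⟩ʳ x)
    answer′ {x} {w} qxw with swap-cases σ a b x
    ... | inj₁ x∈ab = mk⇔ (λ w≡σx → ⊥-elim (¬r (subst (T ∘ q x) w≡σx qxw)))
                          (λ w≡σ′x → ⊥-elim (¬r′ (q⊆q′ (subst (T ∘ q x) w≡σ′x qxw))))
      where
      ¬r = proj₁ (swap-ends s x∈ab)
      ¬r′ = proj₂ (swap-ends s x∈ab)
    ... | inj₂ fixed = subst (λ y → (w ≡ σ ⟨$⟩ʳ x) ⇔ (w ≡ y)) (sym fixed) ⇔.refl

  newlyConfirmed : Permutation′ n → Fin n → Bool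
  newlyConfirmed σ x = not (confirmed q σ x) ∧ confirmed q′ σ x

  pending : Permutation′ n → ℕ
  pending σ = ∑[ x < n ] 𝟙 (newlyConfirmed σ x)

  pending≤n : ∀ σ → pending σ ≤ n
  pending≤n σ = ≤-trans (∑-mono-≤ λ x → 𝟙≤1 (newlyConfirmed σ x)) (≤-reflexive ∑-1)

  swap-newly≡0 : ∀ {σ a b x} → Swappable σ a b → x ≡ a ⊎ x ≡ b →
    𝟙 (newlyConfirmed (swap σ a b) x) ≡ 0
  swap-newly≡0 s x∈ab = 𝟙-∧-false (proj₂ (swap-ends s x∈ab))

  swap-newly-≤ : ∀ {σ a b} → Swappable σ a b →
    ∀ x → 𝟙 (newlyConfirmed (swap σ a b) x) ≤ 𝟙 (newlyConfirmed σ x)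
  swap-newly-≤ {σ} {a} {b} s x with swap-cases σ a b x
  ... | inj₁ x∈ab = subst (_≤ _) (sym (swap-newly≡0 s x∈ab)) z≤n
  ... | inj₂ fixed = ≤-reflexive (cong (λ y → 𝟙 (not (q x y) ∧ q′ x y)) fixed)

  swap-pending : ∀ {σ a b} → Swappable σ a b → pending (swap σ a b) < pending σ
  swap-pending {σ} {a} {b} s with contested-ends σ a b (contested-pair s)
  ... | ¬ra , _ , inj₁ r′a = ∑-mono-< (swap-newly-≤ s) a
                               (subst (_< _) (sym (swap-newly≡0 s (inj₁ refl))) (0<𝟙-not∧ ¬ra r′a))
  ... | _ , ¬rb , inj₂ r′b = ∑-mono-< (swap-newly-≤ s) b
                               (subst (_< _) (sym (swap-newly≡0 s (inj₂ refl))) (0<𝟙-not∧ ¬rb r′b))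

  settled : ∀ {σ} → (∀ a b → ¬ Swappable σ a b) → Settled q q′ σ
  settled {σ} none a b c with T? (q′ a (σ ⟨$⟩ʳ b)) | T? (q′ b (σ ⟨$⟩ʳ a))
  ... | yes blocked | _ = inj₁ blocked
  ... | no _ | yes blocked = inj₂ blocked
  ... | no ¬blockedˡ | no ¬blockedʳ = ⊥-elim (none a b (swappable c ¬blockedˡ ¬blockedʳ))

  swappable-pair? : ∀ σ → Dec (∃ λ a → ∃ λ b → Swappable σ a b)
  swappable-pair? σ = any? λ a → any? λ b → swappable? σ a b

  settleWithin : ℕ → Permutation′ n → Permutation′ n
  settleWithin zero σ = σ
  settleWithin (suc k) σ with swappable-pair? σ
  ... | yes (a , b , _) = settleWithin k (swap σ a b)
  ... | no _ = σ

  settleWithin-agree : ∀ k σ → Agree q σ (settleWithin k σ)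
  settleWithin-agree zero σ = Agree-refl
  settleWithin-agree (suc k) σ with swappable-pair? σ
  ... | yes (a , b , s) = Agree-trans (swap-agree s) (settleWithin-agree k (swap σ a b))
  ... | no _ = Agree-refl

  settleWithin-settled : ∀ k σ → pending σ ≤ k → Settled q q′ (settleWithin k σ)
  settleWithin-settled zero σ pending≤0 =
    settled {σ} λ a b s → n≮0 (<-≤-trans (swap-pending s) pending≤0)
  settleWithin-settled (suc k) σ pending≤k with swappable-pair? σ
  ... | yes (a , b , s) =
    settleWithin-settled k (swap σ a b) (≤-pred (<-≤-trans (swap-pending s) pending≤k))
  ... | no none = settled {σ} λ a b s → none (a , b , s)

  settle : Permutation′ n → Permutation′ n
  settle = settleWithin n

  settle-agree : ∀ σ → Agree q σ (settle σ)
  settle-agree = settleWithin-agree n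

  settle-settled : ∀ σ → Settled q q′ (settle σ)
  settle-settled σ = settleWithin-settled n σ (pending≤n σ)

-- The game

queried : (ℕ → Permutation′ n) → ℕ → Queries n
queried g zero a w = false
queried g (suc t) a w = queried g t a w ∨ does (g t ⟨$⟩ʳ a ≟ w)

queried-⊆-suc : ∀ (g : ℕ → Permutation′ n) t → queried g t ⊆ queried g (suc t)
queried-⊆-suc g t qaw = Equivalence.from T-∨ (inj₁ qaw)

queried-mono : ∀ (g : ℕ → Permutation′ n) {s t} → s ≤ t → queried g s ⊆ queried g t
queried-mono g {t = zero} z≤n qaw = qaw
queried-mono g {t = suc t} s≤1+t qaw with m≤n⇒m<n∨m≡n s≤1+t
... | inj₁ s<1+t = queried-⊆-suc g t (queried-mono g (≤-pred s<1+t) qaw)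
... | inj₂ refl = qaw

queried-guess : ∀ (g : ℕ → Permutation′ n) {s t} → s < t → ∀ a → T (queried g t a (g s ⟨$⟩ʳ a))
queried-guess g {s} s<t a = queried-mono g s<t (Equivalence.from T-∨ (inj₂ asked-now))
  where
  asked-now : T (does (g s ⟨$⟩ʳ a ≟ g s ⟨$⟩ʳ a))
  asked-now = Equivalence.from Bool.T-≡ (dec-true (g s ⟨$⟩ʳ a ≟ g s ⟨$⟩ʳ a) refl)

queried-cong : ∀ {g g′ : ℕ → Permutation′ n} t → (∀ {s} → s < t → g s ≡ g′ s) →
  ∀ a w → queried g t a w ≡ queried g′ t a w
queried-cong zero _ a w = refl
queried-cong (suc t) g≡g′ a w =
  cong₂ _∨_ (queried-cong t (g≡g′ ∘ m<n⇒m<1+n) a w) (cong (λ π → does (π ⟨$⟩ʳ a ≟ w)) (g≡g′ ≤-refl))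

size : Queries n → ℕ
size {n} q = ∑[ a < n ] ∑[ w < n ] 𝟙 (q a w)

potential≤size : ∀ (q : Queries n) σ → potential q σ ≤ size q
potential≤size q σ = ∑∑-mono-≤ λ a w → 𝟙-∧-≤ʳ _ (q a w)

diffCount-∑ : ∀ (π ρ : Permutation′ n) →
  diffCount π ρ ≡ ∑[ a < n ] 𝟙 (not (does (π ⟨$⟩ʳ a ≟ ρ ⟨$⟩ʳ a)))
diffCount-∑ π ρ = length-filter-tabulate (λ a → ¬? (π ⟨$⟩ʳ a ≟ ρ ⟨$⟩ʳ a)) (λ a → a)

𝟙-∨-≟-≤ : ∀ b {x y w : Fin n} → (x ≡ w → T b) →
  𝟙 (b ∨ does (y ≟ w)) ≤ 𝟙 b + 𝟙 (does (y ≟ w)) * 𝟙 (not (does (x ≟ y)))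
𝟙-∨-≟-≤ true _ = s≤s z≤n
𝟙-∨-≟-≤ false {x} {y} {w} x≡w⇒b with y ≟ w | x ≟ y
... | no _ | _ = z≤n
... | yes _ | no _ = ≤-refl
... | yes refl | yes refl = ⊥-elim (x≡w⇒b refl)

size-step : ∀ (g : ℕ → Permutation′ n) s →
  size (queried g (suc (suc s))) ≤ size (queried g (suc s)) + diffCount (g s) (g (suc s))
size-step {n} g s = begin
  size (queried g (suc (suc s)))
    ≤⟨ ∑∑-mono-≤ (λ a w → 𝟙-∨-≟-≤ (Q a w) {y = g (suc s) ⟨$⟩ʳ a} λ x≡w →
         subst (T ∘ Q a) x≡w (queried-guess g ≤-refl a)) ⟩
  ∑[ a < n ] ∑[ w < n ] (𝟙 (Q a w) + 𝟙 (new a w) * moved a)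
    ≡⟨ ∑∑-distrib-+ (λ a w → 𝟙 (Q a w)) (λ a w → 𝟙 (new a w) * moved a) ⟩
  size Q + ∑[ a < n ] ∑[ w < n ] (𝟙 (new a w) * moved a)
    ≡⟨ cong (size Q +_) (sum-cong-≗ λ a → new-once a) ⟩
  size Q + ∑[ a < n ] moved a
    ≡⟨ cong (size Q +_) (sym (diffCount-∑ (g s) (g (suc s)))) ⟩
  size Q + diffCount (g s) (g (suc s)) ∎
  where
  open ≤-Reasoning
  Q = queried g (suc s)
  new : Fin n → Fin n → Bool
  new a w = does (g (suc s) ⟨$⟩ʳ a ≟ w)
  moved : Fin n → ℕ
  moved a = 𝟙 (not (does (g s ⟨$⟩ʳ a ≟ g (suc s) ⟨$⟩ʳ a)))
  new-once : ∀ a → ∑[ w < n ] (𝟙 (new a w) * moved a) ≡ moved a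
  new-once a = begin-equality
    ∑[ w < n ] (𝟙 (new a w) * moved a) ≡⟨ sym (*-distribʳ-sum (moved a) (𝟙 ∘ new a)) ⟩
    ∑[ w < n ] 𝟙 (new a w) * moved a   ≡⟨ cong (_* moved a) (∑-𝟙-≟ (g (suc s) ⟨$⟩ʳ a)) ⟩
    1 * moved a                        ≡⟨ *-identityˡ (moved a) ⟩
    moved a ∎

size-queried : ∀ (g : ℕ → Permutation′ n) k t → (∀ {s} → s < t → diffCount (g s) (g (suc s)) ≤ k) →
  size (queried g (suc t)) ≤ n + k * t
size-queried {n} g k zero _ = begin
  size (queried g 1)   ≡⟨ sum-cong-≗ (λ a → ∑-𝟙-≟ (g 0 ⟨$⟩ʳ a)) ⟩
  ∑[ a < n ] 1         ≡⟨ ∑-1 ⟩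
  n                    ≤⟨ m≤m+n n (k * 0) ⟩
  n + k * 0 ∎
  where open ≤-Reasoning
size-queried {n} g k (suc t) local = begin
  size (queried g (suc (suc t)))                    ≤⟨ size-step g t ⟩
  size (queried g (suc t)) + diffCount (g t) (g (suc t))
    ≤⟨ +-mono-≤ (size-queried g k t (local ∘ m<n⇒m<1+n)) (local ≤-refl) ⟩
  n + k * t + k                                     ≡⟨ +-assoc n (k * t) k ⟩
  n + (k * t + k)                                   ≡⟨ cong (n +_) (+-comm (k * t) k) ⟩
  n + (k + k * t)                                   ≡⟨ cong (n +_) (sym (*-suc k t)) ⟩
  n + k * suc t ∎
  where open ≤-Reasoning

firstFeedback-cong : ∀ (π σ σ′ : Permutation′ n) →
  (∀ i → (π ⟨$⟩ʳ i ≡ σ ⟨$⟩ʳ i) ⇔ (π ⟨$⟩ʳ i ≡ σ′ ⟨$⟩ʳ i)) → firstFeedback π σ ≡ firstFeedback π σ′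
firstFeedback-cong π σ σ′ same = tabulate-cong λ i →
  cong just (does-⇔ (same i) (π ⟨$⟩ʳ i ≟ σ ⟨$⟩ʳ i) (π ⟨$⟩ʳ i ≟ σ′ ⟨$⟩ʳ i))

laterFeedback-cong : ∀ (π π₀ σ σ′ : Permutation′ n) →
  (∀ i → (π ⟨$⟩ʳ i ≡ σ ⟨$⟩ʳ i) ⇔ (π ⟨$⟩ʳ i ≡ σ′ ⟨$⟩ʳ i)) →
  laterFeedback π π₀ σ ≡ laterFeedback π π₀ σ′
laterFeedback-cong π π₀ σ σ′ same = tabulate-cong λ i →
  cong (λ b → if does (π ⟨$⟩ʳ i ≟ π₀ ⟨$⟩ʳ i) then nothing else just b)
       (does-⇔ (same i) (π ⟨$⟩ʳ i ≟ σ ⟨$⟩ʳ i) (π ⟨$⟩ʳ i ≟ σ′ ⟨$⟩ʳ i))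

first-witness : ∀ {P : ℕ → Set} → Decidable P → ∀ {t} → P t →
  ∃ λ s → s ≤ t × P s × (∀ {r} → r < s → ¬ P r)
first-witness {P} P? {t} = <-rec Witnessed step t
  where
  Witnessed : ℕ → Set
  Witnessed t = P t → ∃ λ s → s ≤ t × P s × (∀ {r} → r < s → ¬ P r)
  step : ∀ t → (∀ {s} → s < t → Witnessed s) → Witnessed t
  step t earlier pt with anyUpTo? P? t
  ... | yes (s , s<t , ps) =
    let (r , r≤s , pr , first) = earlier s<t ps in r , ≤-trans r≤s (<⇒≤ s<t) , pr , first
  ... | no none = t , ≤-refl , pt , λ r<t pr → none (_ , r<t , pr)

2[n+kt]≤3n+2k[1+t] : ∀ n k t → 2 * (n + k * t) ≤ 3 * n + 2 * k * suc t
2[n+kt]≤3n+2k[1+t] n k t = ≤-trans (m≤m+n _ (n + 2 * k)) (≤-reflexive (rearrange n k t))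
  where
  rearrange : ∀ n k t → 2 * (n + k * t) + (n + 2 * k) ≡ 3 * n + 2 * k * suc t
  rearrange = solve-∀

n²≤t⇒n²≤3n+2k[1+t] : ∀ n k t → 1 ≤ k → n * n ≤ t → n * n ≤ 3 * n + 2 * k * suc t
n²≤t⇒n²≤3n+2k[1+t] n (suc k) t _ n²≤t = begin
  n * n                  ≤⟨ n²≤t ⟩
  t                      ≤⟨ n≤1+n t ⟩
  suc t                  ≤⟨ m≤n*m (suc t) (2 * suc k) ⟩
  2 * suc k * suc t      ≤⟨ m≤n+m _ (3 * n) ⟩
  3 * n + 2 * suc k * suc t ∎
  where open ≤-Reasoning

module Game (S : Strategy n) where

  asked : Permutation′ n → ℕ → Queries n
  asked σ = queried (guess S σ)

  history-agree : ∀ {σ σ′} t → Agree (asked σ t) σ σ′ → history S σ t ≡ history S σ′ t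
  history-agree zero _ = refl
  history-agree {σ} {σ′} (suc zero) agree =
    cong (_∷ []) (firstFeedback-cong (guess S σ 0) σ σ′ λ i →
      answer agree (queried-guess (guess S σ) {0} ≤-refl i))
  history-agree {σ} {σ′} (suc (suc t)) agree = cong₂ _∷_
    (trans (laterFeedback-cong (guess S σ (suc t)) (guess S σ t) σ σ′ λ i →
              answer agree (queried-guess (guess S σ) {suc t} ≤-refl i))
           (cong₂ (λ h h₀ → laterFeedback (S h) (S h₀) σ′)
                  (history-agree (suc t) agree₁) (history-agree t agree₀)))
    (history-agree (suc t) agree₁)
    where
    agree₁ : Agree (asked σ (suc t)) σ σ′
    agree₁ = Agree-mono (queried-⊆-suc (guess S σ) (suc t)) agree
    agree₀ : Agree (asked σ t) σ σ′
    agree₀ = Agree-mono (queried-⊆-suc (guess S σ) t) agree₁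

  guess-agree : ∀ {σ σ′ s t} → s ≤ t → Agree (asked σ t) σ σ′ → guess S σ s ≡ guess S σ′ s
  guess-agree {σ} s≤t agree =
    cong S (history-agree _ (Agree-mono (queried-mono (guess S σ) s≤t) agree))

  asked-agree : ∀ {σ σ′ s t} → s ≤ suc t → Agree (asked σ t) σ σ′ →
    ∀ a w → asked σ s a w ≡ asked σ′ s a w
  asked-agree {s = s} s≤1+t agree =
    queried-cong s λ r<s → guess-agree (≤-pred (≤-trans r<s s≤1+t)) agree

  module Round (σ : Permutation′ n) (m : ℕ) =
    Settle (asked σ m) (asked σ (suc m)) (queried-⊆-suc (guess S σ) m)

  adversary : ℕ → Permutation′ n
  adversary zero = id
  adversary (suc m) = Round.settle (adversary m) m (adversary m)

  adversary-agree-suc : ∀ m → Agree (asked (adversary m) m) (adversary m) (adversary (suc m))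
  adversary-agree-suc m = Round.settle-agree (adversary m) m (adversary m)

  adversary-invariant : ∀ m → Invariant (asked (adversary m) m) (adversary m)
  adversary-invariant zero = invariant-empty (adversary zero)
  adversary-invariant (suc m) =
    invariant-cong {σ = adversary (suc m)} (asked-agree ≤-refl (adversary-agree-suc m))
      (invariant-extend {q = asked σₘ m} {asked σₘ (suc m)} {adversary (suc m)}
        (queried-⊆-suc (guess S σₘ) m) (Round.settle-settled σₘ m σₘ)
        (invariant-agree (adversary-agree-suc m) (adversary-invariant m)))
    where σₘ = adversary m

  adversary-stable : ∀ {t} d → Agree (asked (adversary t) t) (adversary t) (adversary (d + t))
  adversary-stable zero = Agree-refl
  adversary-stable {t} (suc d) =
    Agree-trans (adversary-stable d) (Agree-mono earlier (adversary-agree-suc (d + t)))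
    where
    earlier : asked (adversary t) t ⊆ asked (adversary (d + t)) (d + t)
    earlier {a} {w} asked-aw = queried-mono _ (m≤n+m t d)
      (subst T (asked-agree (n≤1+n t) (adversary-stable d) a w) asked-aw)

  won-bound : ∀ {k N t} → Local k S → t < N → guess S (adversary N) t ≈ adversary N →
    (∀ {s} → s < t → ¬ guess S (adversary N) s ≈ adversary N) → n * n ≤ 2 * (n + k * t)
  won-bound {k} {N} {t} local t<N won not-yet = begin
    n * n                       ≤⟨ subst (λ u → n * n ≤ 2 * potential Q τ + u * u) none-left
                                     (adversary-invariant (suc t)) ⟩
    2 * potential Q τ + 0       ≡⟨ +-identityʳ _ ⟩
    2 * potential Q τ           ≤⟨ *-monoʳ-≤ 2 (potential≤size Q τ) ⟩
    2 * size Q                  ≤⟨ *-monoʳ-≤ 2 (size-queried (guess S τ) k t moves) ⟩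
    2 * (n + k * t) ∎
    where
    open ≤-Reasoning
    σ* = adversary N
    τ = adversary (suc t)
    Q = asked τ (suc t)
    agree : Agree Q τ σ*
    agree = subst (Agree Q τ ∘ adversary) (m∸n+n≡m t<N) (adversary-stable (N ∸ suc t))
    same : ∀ {s} → s ≤ suc t → guess S τ s ≡ guess S σ* s
    same s≤1+t = guess-agree s≤1+t agree
    all-confirmed : ∀ a → T (confirmed Q τ a)
    all-confirmed a = subst (T ∘ Q a) (Equivalence.from (answer agree asked-last) hit) asked-last
      where
      asked-last = queried-guess (guess S τ) ≤-refl a
      hit : guess S τ t ⟨$⟩ʳ a ≡ σ* ⟨$⟩ʳ a
      hit = trans (cong (_⟨$⟩ʳ a) (same (n≤1+n t))) (won a)
    none-left : unconfirmed Q τ ≡ 0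
    none-left = unconfirmed≡0 {q = Q} {σ = τ} all-confirmed
    moves : ∀ {s} → s < t → diffCount (guess S τ s) (guess S τ (suc s)) ≤ k
    moves {s} s<t = subst₂ (λ π ρ → diffCount π ρ ≤ k)
      (sym (same (≤-trans (<⇒≤ s<t) (n≤1+n t)))) (sym (same (≤-trans s<t (n≤1+n t))))
      (local σ* s λ r r≤s → not-yet (≤-<-trans r≤s s<t))

  secret : Permutation′ n
  secret = adversary (n * n)

  -- Once n * n guesses have been made the bound holds whatever the secret, so the
  -- adversary only needs to be followed for n * n rounds.
  first-win-bound : ∀ {k t} → 1 ≤ k → Local k S → guess S secret t ≈ secret →
    (∀ {s} → s < t → ¬ guess S secret s ≈ secret) → n * n ≤ 3 * n + 2 * k * suc t
  first-win-bound {k} {t} 1≤k local won not-yet with t <? n * n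
  ... | yes t<N = ≤-trans (won-bound local t<N won not-yet) (2[n+kt]≤3n+2k[1+t] n k t)
  ... | no t≮N = n²≤t⇒n²≤3n+2k[1+t] n k t 1≤k (≮⇒≥ t≮N)

lemma9 : (k n : ℕ) → 2 ≤ k → 2 ≤ n → (S : Strategy n) → Local k S →
    ∃ λ (σ : Permutation′ n) → ∀ t → guess S σ t ≈ σ →
      n * n ≤ 3 * n + 2 * k * suc t
lemma9 k n 2≤k _ S local = secret , bound
  where
  open Game S
  bound : ∀ t → guess S secret t ≈ secret → n * n ≤ 3 * n + 2 * k * suc t
  bound t won with first-witness (λ s → all? λ i → guess S secret s ⟨$⟩ʳ i ≟ secret ⟨$⟩ʳ i) won
  ... | s , s≤t , won-s , not-yet =
    ≤-trans (first-win-bound (≤-trans (s≤s z≤n) 2≤k) local won-s not-yet)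
            (+-monoʳ-≤ (3 * n) (*-monoʳ-≤ (2 * k) (s≤s s≤t)))
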